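{- For the simple wheel graph $W_n$ ($n\ge 3$), $\Gamma(W_n)\cong\mathbb{Z}_2^n$.
   Context: For $n\ge3$, the simple wheel $W_n$ is obtained from a simple cycle on $n$ vertices by adding a new central vertex joined by a single edge to each of the $n$ cycle vertices. For a graph $G$ (finite, no loops) with $E(v)$ the set of edges at $v$, $\Gamma(G)$ is the group generated by $\{x_e:e\in E(G)\}$ with relations $x_e^2=1$, $[x_e,x_{e'}]=1$ whenever $e,e'\in E(v)$ for some vertex $v$, and $\prod_{e\in E(v)}x_e=1$ for each vertex $v$. -}

module Defs where

open import Level using (0ℓ)
open import Data.Nat using (ℕ; zero; suc; _+_)
open import Data.Nat.DivMod using (_%_; m%n<n)
open import Data.Fin using (Fin; zero; suc; toℕ; fromℕ<; splitAt; _≟_)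
open import Data.Sum using (_⊎_; inj₁; inj₂)
open import Data.List using (List; []; _∷_; _++_; map; reverse; filter)
open import Data.List.Membership.Propositional using (_∈_)
open import Data.Vec using (Vec; zipWith; replicate)
open import Data.Bool using (Bool; false; true; _xor_)
open import Data.Product using (_×_; _,_)
open import Relation.Nullary.Decidable using (_⊎-dec_)
open import Relation.Binary.PropositionalEquality using (_≡_)
open import Algebra.Bundles.Raw using (RawGroup)
open import Data.List using (allFin) public

record Graph : Set where
  field
    nV  : ℕ
    nE  : ℕ
    src : Fin nE → Fin nV
    tgt : Fin nE → Fin nV

open Graph public

incident : (G : Graph) → Fin (nV G) → List (Fin (nE G))
incident G v = filter (λ e → (v ≟ src G e) ⊎-dec (v ≟ tgt G e)) (allFin (nE G))

data Letter (m : ℕ) : Set where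
  pos : Fin m → Letter m
  neg : Fin m → Letter m

flipL : ∀ {m} → Letter m → Letter m
flipL (pos e) = neg e
flipL (neg e) = pos e

Word : ℕ → Set
Word m = List (Letter m)

invW : ∀ {m} → Word m → Word m
invW w = reverse (map flipL w)

-- The congruence on words defining the presented group Γ(G):
-- smallest congruence containing free cancellation and relators ~ empty word.
data Rel (G : Graph) : Word (nE G) → Word (nE G) → Set where
  ~refl  : ∀ {u} → Rel G u u
  ~sym   : ∀ {u v} → Rel G u v → Rel G v u
  ~trans : ∀ {u v w} → Rel G u v → Rel G v w → Rel G u w
  ~ctx   : ∀ {u v} (a b : Word (nE G)) → Rel G u v → Rel G (a ++ u ++ b) (a ++ v ++ b)
  ~free  : ∀ (l : Letter (nE G)) → Rel G (l ∷ flipL l ∷ []) []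
  ~sq    : ∀ (e : Fin (nE G)) → Rel G (pos e ∷ pos e ∷ []) []
  ~comm  : ∀ (v : Fin (nV G)) (e e' : Fin (nE G)) → e ∈ incident G v → e' ∈ incident G v →
           Rel G (pos e ∷ pos e' ∷ neg e ∷ neg e' ∷ []) []
  ~vert  : ∀ (v : Fin (nV G)) → Rel G (map pos (incident G v)) []

Γ : Graph → RawGroup 0ℓ 0ℓ
Γ G = record
  { Carrier = Word (nE G)
  ; _≈_ = Rel G
  ; _∙_ = _++_
  ; ε = []
  ; _⁻¹ = invW
  }

Z2^ : ℕ → RawGroup 0ℓ 0ℓ
Z2^ n = record
  { Carrier = Vec Bool n
  ; _≈_ = _≡_
  ; _∙_ = zipWith _xor_
  ; ε = replicate n false
  ; _⁻¹ = λ v → v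
  }

next : ∀ {n} → Fin n → Fin n
next {suc m} i = fromℕ< (m%n<n (suc (toℕ i)) (suc m))

-- The wheel W_n: vertex zero is the centre, suc i is the i-th cycle vertex.
-- Edges Fin (n + n): the first n are spokes {centre, i},
-- the last n are rim edges {i, i+1 mod n}.
wheel : ℕ → Graph
wheel n = record
  { nV = suc n
  ; nE = n + n
  ; src = λ e → s (splitAt n e)
  ; tgt = λ e → t (splitAt n e)
  }
  where
  s : Fin n ⊎ Fin n → Fin (suc n)
  s (inj₁ i) = zero
  s (inj₂ i) = suc i
  t : Fin n ⊎ Fin n → Fin (suc n)
  t (inj₁ i) = suc i
  t (inj₂ i) = suc (next i)

module Submission where

-- Write s_c, r_j for the generators of the spoke to cycle vertex c and of the rim edge {j, j+1}.
-- Sending r_j to the basis vector e_j and s_c to e_c + e_{c-1} kills every relator, giving a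
-- homomorphism φ : Γ(W_n) → ℤ₂ⁿ that is onto.  Conversely, the relator at cycle vertex c reads
-- s_c = r_{c-1} r_c, so the rims generate.  The spokes pairwise commute (they meet at the centre),
-- r_0 r_j = s_1 ⋯ s_j telescopes, and a product xy of involutions that equals a product of commuting
-- involutions satisfies (xy)² = 1; hence all rims commute.  A word is therefore the product, in index
-- order, of the rims occurring an odd number of times in its rim expansion, and those are read off φ.

open import Defs
open import Function using (_∘_)
open import Data.Empty using (⊥; ⊥-elim)
open import Data.Unit using (⊤; tt)
open import Data.Nat using (ℕ; zero; suc; _+_; _≤_; _<_; s≤s)
import Data.Nat.Properties as ℕ
open import Data.Nat.DivMod using (_%_; n%n≡0; m<n⇒m%n≡m)
open import Data.Fin using (Fin; zero; suc; toℕ; fromℕ; inject₁; _↑ˡ_; _↑ʳ_; splitAt; join; _≟_)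
open import Data.Fin.Properties
  using (toℕ-injective; toℕ-fromℕ<; toℕ-fromℕ; toℕ-inject₁; toℕ<n; splitAt-↑ˡ; splitAt-↑ʳ; join-splitAt; ↑ˡ-injective; ↑ʳ-injective)
open import Data.Fin.Induction using (<-weakInduction)
open import Data.Bool using (Bool; true; false; _xor_; _∧_; _∨_)
open import Data.Bool.Properties using (xor-assoc; xor-comm; xor-identityʳ; ∧-comm; ∧-identityʳ; ∧-zeroʳ; ∧-distribʳ-xor; xor-∧-commutativeRing)
open import Data.Sum using (_⊎_; inj₁; inj₂; [_,_]′)
open import Data.Product using (∃; _,_)
open import Data.List using (List; []; _∷_; _++_; map; reverse; filter; filterᵇ; allFin; [_])
open import Data.List.Properties using (map-tabulate; ++-identityʳ; ++-assoc; map-++; unfold-reverse)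
open import Data.List.Relation.Unary.All using (All; []; _∷_)
import Data.List.Relation.Unary.All as All
open import Data.List.Relation.Unary.Any using (here; there)
open import Data.List.Relation.Unary.Unique.Propositional using (Unique)
open import Data.List.Relation.Unary.Unique.Propositional.Properties using (allFin⁺)
open import Data.List.Relation.Unary.AllPairs using ([]; _∷_)
open import Data.List.Membership.Propositional using (_∈_)
open import Data.List.Membership.Propositional.Properties using (∈-filter⁺; ∈-allFin)
open import Data.Vec using (Vec; _∷_; tabulate; lookup; zipWith; replicate)
import Data.Vec.Properties as Vec
open import Relation.Nullary using (¬_; Dec; yes; no; does)
open import Relation.Nullary.Decidable using (_⊎-dec_)
open import Relation.Binary.PropositionalEquality using (_≡_; refl; sym; trans; cong; cong₂; subst; subst₂; module ≡-Reasoning)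
open import Relation.Binary.Bundles using (Setoid)
open import Relation.Binary.Definitions using (tri<; tri≈; tri>)
import Relation.Binary.Reasoning.Setoid as SetoidReasoning
open import Algebra.Bundles using (CommutativeRing)
open import Algebra.Properties.CommutativeSemigroup (CommutativeRing.+-commutativeSemigroup xor-∧-commutativeRing)
  using (interchange)
open import Algebra.Morphism.Structures using (module GroupMorphisms)

_≡ᵇ_ : ∀ {N} → Fin N → Fin N → Bool
i ≡ᵇ j = does (i ≟ j)

≡ᵇ-refl : ∀ {N} (i : Fin N) → (i ≡ᵇ i) ≡ true
≡ᵇ-refl i with i ≟ i
... | yes _  = refl
... | no i≢i = ⊥-elim (i≢i refl)

≢⇒≡ᵇ-false : ∀ {N} {i j : Fin N} → ¬ i ≡ j → (i ≡ᵇ j) ≡ false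
≢⇒≡ᵇ-false {i = i} {j} i≢j with i ≟ j
... | yes i≡j = ⊥-elim (i≢j i≡j)
... | no _    = refl

≡ᵇ⇒≡ : ∀ {N} {i j : Fin N} → (i ≡ᵇ j) ≡ true → i ≡ j
≡ᵇ⇒≡ {i = i} {j} eq with i ≟ j
... | yes i≡j = i≡j

≡ᵇ-sym : ∀ {N} (i j : Fin N) → (i ≡ᵇ j) ≡ (j ≡ᵇ i)
≡ᵇ-sym i j with i ≟ j
... | yes refl = sym (≡ᵇ-refl i)
... | no i≢j   = sym (≢⇒≡ᵇ-false (i≢j ∘ sym))

≡ᵇ-injective : ∀ {N M} (f : Fin N → Fin M) → (∀ {i j} → f i ≡ f j → i ≡ j) →
               ∀ i j → (f i ≡ᵇ f j) ≡ (i ≡ᵇ j)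
≡ᵇ-injective f f-inj i j with i ≟ j
... | yes refl = ≡ᵇ-refl (f i)
... | no i≢j   = ≢⇒≡ᵇ-false (i≢j ∘ f-inj)

filterᵇ-accept : ∀ {A : Set} (d : A → Bool) {x} xs → d x ≡ true → filterᵇ d (x ∷ xs) ≡ x ∷ filterᵇ d xs
filterᵇ-accept d xs dx rewrite dx = refl

filterᵇ-reject : ∀ {A : Set} (d : A → Bool) {x} xs → d x ≡ false → filterᵇ d (x ∷ xs) ≡ filterᵇ d xs
filterᵇ-reject d xs dx rewrite dx = refl

filterᵇ-cong : ∀ {A : Set} {d d′ : A → Bool} {xs} → All (λ x → d x ≡ d′ x) xs → filterᵇ d xs ≡ filterᵇ d′ xs
filterᵇ-cong {xs = []}     []             = refl
filterᵇ-cong {d′ = d′} {x ∷ xs} (dx≡d′x ∷ eqs) rewrite dx≡d′x with d′ x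
... | true  = cong (x ∷_) (filterᵇ-cong eqs)
... | false = filterᵇ-cong eqs

filterᵇ-false : ∀ {A : Set} (xs : List A) → filterᵇ (λ _ → false) xs ≡ []
filterᵇ-false []       = refl
filterᵇ-false (x ∷ xs) = filterᵇ-false xs

filter≡filterᵇ : ∀ {A : Set} {P : A → Set} (P? : ∀ x → Dec (P x)) xs → filter P? xs ≡ filterᵇ (does ∘ P?) xs
filter≡filterᵇ P? []       = refl
filter≡filterᵇ P? (x ∷ xs) with does (P? x)
... | true  = cong (x ∷_) (filter≡filterᵇ P? xs)
... | false = filter≡filterᵇ P? xs

parity : {A : Set} → (A → Bool) → List A → Bool
parity f []       = false
parity f (x ∷ xs) = f x xor parity f xs

parity-++ : ∀ {A : Set} (f : A → Bool) xs ys → parity f (xs ++ ys) ≡ parity f xs xor parity f ys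
parity-++ f []       ys = refl
parity-++ f (x ∷ xs) ys = trans (cong (f x xor_) (parity-++ f xs ys)) (sym (xor-assoc (f x) _ _))

parity-map : ∀ {A B : Set} (f : B → Bool) (g : A → B) xs → parity f (map g xs) ≡ parity (f ∘ g) xs
parity-map f g []       = refl
parity-map f g (x ∷ xs) = cong (f (g x) xor_) (parity-map f g xs)

parity-cong : ∀ {A : Set} {f g : A → Bool} → (∀ x → f x ≡ g x) → ∀ xs → parity f xs ≡ parity g xs
parity-cong f≗g []       = refl
parity-cong f≗g (x ∷ xs) = cong₂ _xor_ (f≗g x) (parity-cong f≗g xs)

parity-false : ∀ {A : Set} (xs : List A) → parity (λ _ → false) xs ≡ false
parity-false []       = refl
parity-false (x ∷ xs) = parity-false xs

parity-xor : ∀ {A : Set} (f g : A → Bool) xs → parity (λ x → f x xor g x) xs ≡ parity f xs xor parity g xs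
parity-xor f g []       = refl
parity-xor f g (x ∷ xs) = trans (cong ((f x xor g x) xor_) (parity-xor f g xs)) (interchange (f x) (g x) _ _)

parity-reverse : ∀ {A : Set} (f : A → Bool) xs → parity f (reverse xs) ≡ parity f xs
parity-reverse f []       = refl
parity-reverse f (x ∷ xs) = begin
  parity f (reverse (x ∷ xs))           ≡⟨ cong (parity f) (unfold-reverse x xs) ⟩
  parity f (reverse xs ++ [ x ])        ≡⟨ parity-++ f (reverse xs) [ x ] ⟩
  parity f (reverse xs) xor (f x xor false) ≡⟨ cong₂ _xor_ (parity-reverse f xs) (xor-identityʳ (f x)) ⟩
  parity f xs xor f x                   ≡⟨ xor-comm (parity f xs) (f x) ⟩
  parity f (x ∷ xs)                     ∎
  where open ≡-Reasoning

parity-filterᵇ : ∀ {A : Set} (f d : A → Bool) xs → parity f (filterᵇ d xs) ≡ parity (λ x → d x ∧ f x) xs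
parity-filterᵇ f d []       = refl
parity-filterᵇ f d (x ∷ xs) with d x
... | true  = cong (f x xor_) (parity-filterᵇ f d xs)
... | false = parity-filterᵇ f d xs

parity-allFin-suc : ∀ {N} (f : Fin (suc N) → Bool) → parity f (allFin (suc N)) ≡ f zero xor parity (f ∘ suc) (allFin N)
parity-allFin-suc {N} f = trans (cong (λ xs → parity f (zero ∷ xs)) (sym (map-tabulate (λ i → i) suc)))
                                (cong (f zero xor_) (parity-map f suc (allFin N)))

parity-allFin-δ : ∀ {N} (d : Fin N → Bool) (i : Fin N) → parity (λ j → d j ∧ (j ≡ᵇ i)) (allFin N) ≡ d i
parity-allFin-δ {suc N} d zero = begin
  parity (λ j → d j ∧ (j ≡ᵇ zero)) (allFin (suc N))
    ≡⟨ parity-allFin-suc (λ j → d j ∧ (j ≡ᵇ zero)) ⟩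
  (d zero ∧ true) xor parity (λ j → d (suc j) ∧ false) (allFin N)
    ≡⟨ cong₂ _xor_ (∧-identityʳ (d zero)) (parity-cong (∧-zeroʳ ∘ d ∘ suc) (allFin N)) ⟩
  d zero xor parity (λ _ → false) (allFin N)
    ≡⟨ cong (d zero xor_) (parity-false (allFin N)) ⟩
  d zero xor false
    ≡⟨ xor-identityʳ (d zero) ⟩
  d zero ∎
  where open ≡-Reasoning
parity-allFin-δ {suc N} d (suc i) = begin
  parity (λ j → d j ∧ (j ≡ᵇ suc i)) (allFin (suc N))
    ≡⟨ parity-allFin-suc (λ j → d j ∧ (j ≡ᵇ suc i)) ⟩
  (d zero ∧ false) xor parity (λ j → d (suc j) ∧ (j ≡ᵇ i)) (allFin N)
    ≡⟨ cong (_xor parity (λ j → d (suc j) ∧ (j ≡ᵇ i)) (allFin N)) (∧-zeroʳ (d zero)) ⟩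
  parity (λ j → d (suc j) ∧ (j ≡ᵇ i)) (allFin N)
    ≡⟨ parity-allFin-δ (d ∘ suc) i ⟩
  d (suc i) ∎
  where open ≡-Reasoning

xor≡∨ : ∀ {a b} → (a ≡ true → b ≡ true → ⊥) → a xor b ≡ a ∨ b
xor≡∨ {true}  {true}  not-both = ⊥-elim (not-both refl refl)
xor≡∨ {true}  {false} _        = refl
xor≡∨ {false} {_}     _        = refl

xor-twice : ∀ a b → a xor (b xor (a xor (b xor false))) ≡ false
xor-twice false false = refl
xor-twice false true  = refl
xor-twice true  false = refl
xor-twice true  true  = refl

toggle : ∀ {N} → Fin N → (Fin N → Bool) → Fin N → Bool
toggle i d j = (i ≡ᵇ j) xor d j

toggle-outside : ∀ {N} (d : Fin N → Bool) {i j} → ¬ i ≡ j → toggle i d j ≡ d j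
toggle-outside d i≢j = cong (_xor d _) (≢⇒≡ᵇ-false i≢j)

oddMultiplicity : ∀ {N} → List (Fin N) → Fin N → Bool
oddMultiplicity is j = parity (_≡ᵇ j) is

oddMultiplicity-filterᵇ-allFin : ∀ {N} (d : Fin N → Bool) i → oddMultiplicity (filterᵇ d (allFin N)) i ≡ d i
oddMultiplicity-filterᵇ-allFin {N} d i = trans (parity-filterᵇ (_≡ᵇ i) d (allFin N)) (parity-allFin-δ d i)

oddMultiplicity-allFin : ∀ {N} (i : Fin N) → oddMultiplicity (allFin N) i ≡ true
oddMultiplicity-allFin i = parity-allFin-δ (λ _ → true) i

parity-allFin-oddMultiplicity : ∀ {N} (g : Fin N → Bool) is →
                                parity (λ j → oddMultiplicity is j ∧ g j) (allFin N) ≡ parity g is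
parity-allFin-oddMultiplicity {N} g []       = parity-false (allFin N)
parity-allFin-oddMultiplicity {N} g (i ∷ is) = begin
  parity (λ j → ((i ≡ᵇ j) xor oddMultiplicity is j) ∧ g j) (allFin N)
    ≡⟨ parity-cong (λ j → ∧-distribʳ-xor (g j) (i ≡ᵇ j) _) (allFin N) ⟩
  parity (λ j → ((i ≡ᵇ j) ∧ g j) xor (oddMultiplicity is j ∧ g j)) (allFin N)
    ≡⟨ parity-xor (λ j → (i ≡ᵇ j) ∧ g j) (λ j → oddMultiplicity is j ∧ g j) (allFin N) ⟩
  parity (λ j → (i ≡ᵇ j) ∧ g j) (allFin N) xor parity (λ j → oddMultiplicity is j ∧ g j) (allFin N)
    ≡⟨ cong (_xor _) (parity-cong (λ j → trans (∧-comm (i ≡ᵇ j) (g j)) (cong (g j ∧_) (≡ᵇ-sym i j))) (allFin N)) ⟩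
  parity (λ j → g j ∧ (j ≡ᵇ i)) (allFin N) xor parity (λ j → oddMultiplicity is j ∧ g j) (allFin N)
    ≡⟨ cong₂ _xor_ (parity-allFin-δ g i) (parity-allFin-oddMultiplicity g is) ⟩
  g i xor parity g is ∎
  where open ≡-Reasoning

parity-filterᵇ-oddMultiplicity : ∀ {N} (g : Fin N → Bool) is →
                                 parity g (filterᵇ (oddMultiplicity is) (allFin N)) ≡ parity g is
parity-filterᵇ-oddMultiplicity {N} g is =
  trans (parity-filterᵇ g (oddMultiplicity is) (allFin N)) (parity-allFin-oddMultiplicity g is)

zipWith-tabulate : ∀ {A B C : Set} {N} (f : A → B → C) (g : Fin N → A) (h : Fin N → B) →
                   zipWith f (tabulate g) (tabulate h) ≡ tabulate (λ i → f (g i) (h i))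
zipWith-tabulate {N = zero}  f g h = refl
zipWith-tabulate {N = suc N} f g h = cong (f (g zero) (h zero) ∷_) (zipWith-tabulate f (g ∘ suc) (h ∘ suc))

edge : ∀ {m} → Letter m → Fin m
edge (pos e) = e
edge (neg e) = e

edge-flipL : ∀ {m} (l : Letter m) → edge (flipL l) ≡ edge l
edge-flipL (pos e) = refl
edge-flipL (neg e) = refl

module Presentation (G : Graph) where

  _~_ : Word (nE G) → Word (nE G) → Set
  _~_ = Rel G

  ~-setoid : Setoid _ _
  ~-setoid = record
    { Carrier = Word (nE G) ; _≈_ = _~_
    ; isEquivalence = record { refl = ~refl ; sym = ~sym ; trans = ~trans } }

  ~-prepend : ∀ a {u v} → u ~ v → (a ++ u) ~ (a ++ v)
  ~-prepend a {u} {v} u~v = subst₂ _~_ (cong (a ++_) (++-identityʳ u)) (cong (a ++_) (++-identityʳ v)) (~ctx a [] u~v)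

  Commute : Letter (nE G) → Letter (nE G) → Set
  Commute x y = (x ∷ y ∷ []) ~ (y ∷ x ∷ [])

  Involution : Letter (nE G) → Set
  Involution x = (x ∷ x ∷ []) ~ []

  neg~pos : ∀ e → (neg e ∷ []) ~ (pos e ∷ [])
  neg~pos e = ~trans (~sym (~ctx [] (neg e ∷ []) (~sq e))) (~ctx (pos e ∷ []) [] (~free (pos e)))

  incident-commute : ∀ {v e e′} → e ∈ incident G v → e′ ∈ incident G v → Commute (pos e) (pos e′)
  incident-commute {v} {e} {e′} e∈ e′∈ =
    ~trans (~sym (~ctx (pos e ∷ pos e′ ∷ []) [] (~free (neg e))))
    (~trans (~sym (~ctx (pos e ∷ pos e′ ∷ neg e ∷ []) (pos e ∷ []) (~free (neg e′))))
            (~ctx [] (pos e′ ∷ pos e ∷ []) (~comm v e e′ e∈ e′∈)))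

  commute-of-square : ∀ {x y} → Involution x → Involution y → (x ∷ y ∷ x ∷ y ∷ []) ~ [] → Commute x y
  commute-of-square {x} {y} x² y² xyxy = ~sym
    (~trans (~sym (~ctx (y ∷ x ∷ []) [] xyxy))
    (~trans (~ctx (y ∷ []) (y ∷ x ∷ y ∷ []) x²)
            (~ctx [] (x ∷ y ∷ []) y²)))

  module CommutingGenerators {N} (a : Fin N → Fin (nE G)) (a-commute : ∀ i j → Commute (pos (a i)) (pos (a j))) where

    word : List (Fin N) → Word (nE G)
    word = map (pos ∘ a)

    moves-past : ∀ i is → (pos (a i) ∷ word is) ~ (word is ++ [ pos (a i) ])
    moves-past i []       = ~refl
    moves-past i (j ∷ is) = ~trans (~ctx [] (word is) (a-commute i j)) (~-prepend [ pos (a j) ] (moves-past i is))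

    word-self-cancel : ∀ is → (word is ++ word is) ~ []
    word-self-cancel []       = ~refl
    word-self-cancel (i ∷ is) =
      ~trans (~-prepend [ pos (a i) ] (subst (_~ (pos (a i) ∷ word is ++ word is)) (++-assoc (word is) _ (word is))
                                            (~ctx [] (word is) (~sym (moves-past i is)))))
             (~trans (~ctx [] (word is ++ word is) (~sq (a i))) (word-self-cancel is))

    commute-of-product : ∀ {x y} is → Involution x → Involution y → (x ∷ y ∷ []) ~ word is → Commute x y
    commute-of-product {x} {y} is x² y² xy~w = commute-of-square x² y²
      (~trans (~ctx [] (x ∷ y ∷ []) xy~w) (~trans (~-prepend (word is) xy~w) (word-self-cancel is)))

  module NormalForm {N} (a : Fin N → Fin (nE G)) (Q : Fin N → Set)
                    (a-commute : ∀ {i j} → Q i → Q j → Commute (pos (a i)) (pos (a j))) where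

    word : List (Fin N) → Word (nE G)
    word = map (pos ∘ a)

    normal : (Fin N → Bool) → Word (nE G)
    normal d = word (filterᵇ d (allFin N))

    Supported : (Fin N → Bool) → Set
    Supported d = ∀ i → d i ≡ true → Q i

    toggle-supported : ∀ {i d} → Q i → Supported d → Supported (toggle i d)
    toggle-supported {i} Qi sd j dj with i ≟ j
    ... | yes refl = Qi
    ... | no _     = sd j dj

    oddMultiplicity-supported : ∀ is → All Q is → Supported (oddMultiplicity is)
    oddMultiplicity-supported []       []         j ()
    oddMultiplicity-supported (i ∷ is) (Qi ∷ Qis) = toggle-supported Qi (oddMultiplicity-supported is Qis)

    toggle-filterᵇ : ∀ {i d xs} → Unique xs → i ∈ xs → Q i → Supported d →
                     (pos (a i) ∷ word (filterᵇ d xs)) ~ word (filterᵇ (toggle i d) xs)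
    toggle-filterᵇ {i} {d} {x ∷ xs} (x∉xs ∷ _) (here refl) Qi sd = at-head (d x) refl
      where
      open SetoidReasoning ~-setoid
      tail-unchanged : filterᵇ (toggle x d) xs ≡ filterᵇ d xs
      tail-unchanged = filterᵇ-cong (All.map (toggle-outside d) x∉xs)
      at-head : ∀ b → d x ≡ b → (pos (a x) ∷ word (filterᵇ d (x ∷ xs))) ~ word (filterᵇ (toggle x d) (x ∷ xs))
      at-head true dx = begin
        pos (a x) ∷ word (filterᵇ d (x ∷ xs))       ≡⟨ cong (λ ys → pos (a x) ∷ word ys) (filterᵇ-accept d xs dx) ⟩
        pos (a x) ∷ pos (a x) ∷ word (filterᵇ d xs) ≈⟨ ~ctx [] (word (filterᵇ d xs)) (~sq (a x)) ⟩
        word (filterᵇ d xs)                         ≡⟨ cong word tail-unchanged ⟨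
        word (filterᵇ (toggle x d) xs)              ≡⟨ cong word (filterᵇ-reject (toggle x d) xs (cong₂ _xor_ (≡ᵇ-refl x) dx)) ⟨
        word (filterᵇ (toggle x d) (x ∷ xs))        ∎
      at-head false dx = begin
        pos (a x) ∷ word (filterᵇ d (x ∷ xs))       ≡⟨ cong (λ ys → pos (a x) ∷ word ys) (filterᵇ-reject d xs dx) ⟩
        pos (a x) ∷ word (filterᵇ d xs)             ≡⟨ cong (λ ys → pos (a x) ∷ word ys) tail-unchanged ⟨
        pos (a x) ∷ word (filterᵇ (toggle x d) xs)  ≡⟨ cong word (filterᵇ-accept (toggle x d) xs (cong₂ _xor_ (≡ᵇ-refl x) dx)) ⟨
        word (filterᵇ (toggle x d) (x ∷ xs))        ∎
    toggle-filterᵇ {i} {d} {x ∷ xs} (x∉xs ∷ uxs) (there i∈xs) Qi sd = in-tail (d x) refl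
      where
      open SetoidReasoning ~-setoid
      head-unchanged : toggle i d x ≡ d x
      head-unchanged = toggle-outside d (λ i≡x → All.lookup x∉xs i∈xs (sym i≡x))
      in-tail : ∀ b → d x ≡ b → (pos (a i) ∷ word (filterᵇ d (x ∷ xs))) ~ word (filterᵇ (toggle i d) (x ∷ xs))
      in-tail true dx = begin
        pos (a i) ∷ word (filterᵇ d (x ∷ xs))       ≡⟨ cong (λ ys → pos (a i) ∷ word ys) (filterᵇ-accept d xs dx) ⟩
        pos (a i) ∷ pos (a x) ∷ word (filterᵇ d xs) ≈⟨ ~ctx [] (word (filterᵇ d xs)) (a-commute Qi (sd x dx)) ⟩
        pos (a x) ∷ pos (a i) ∷ word (filterᵇ d xs) ≈⟨ ~-prepend [ pos (a x) ] (toggle-filterᵇ uxs i∈xs Qi sd) ⟩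
        pos (a x) ∷ word (filterᵇ (toggle i d) xs)  ≡⟨ cong word (filterᵇ-accept (toggle i d) xs (trans head-unchanged dx)) ⟨
        word (filterᵇ (toggle i d) (x ∷ xs))        ∎
      in-tail false dx = begin
        pos (a i) ∷ word (filterᵇ d (x ∷ xs))       ≡⟨ cong (λ ys → pos (a i) ∷ word ys) (filterᵇ-reject d xs dx) ⟩
        pos (a i) ∷ word (filterᵇ d xs)             ≈⟨ toggle-filterᵇ uxs i∈xs Qi sd ⟩
        word (filterᵇ (toggle i d) xs)              ≡⟨ cong word (filterᵇ-reject (toggle i d) xs (trans head-unchanged dx)) ⟨
        word (filterᵇ (toggle i d) (x ∷ xs))        ∎

    word~normal : ∀ is → All Q is → word is ~ normal (oddMultiplicity is)
    word~normal []         []         = Setoid.reflexive ~-setoid (cong word (sym (filterᵇ-false (allFin N))))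
    word~normal (i ∷ is)   (Qi ∷ Qis) =
      ~trans (~-prepend [ pos (a i) ] (word~normal is Qis))
             (toggle-filterᵇ (allFin⁺ N) (∈-allFin i) Qi (oddMultiplicity-supported is Qis))

module Cycle (k : ℕ) where

  n : ℕ
  n = suc (suc k)

  prev : Fin n → Fin n
  prev zero    = fromℕ (suc k)
  prev (suc c) = inject₁ c

  private
    data NextView (i : Fin n) : Set where
      wraps : toℕ i ≡ suc k → toℕ (next i) ≡ 0 → NextView i
      steps : toℕ i < suc k → toℕ (next i) ≡ suc (toℕ i) → NextView i

    nextView : ∀ i → NextView i
    nextView i with ℕ.<-cmp (toℕ i) (suc k)
    ... | tri< i<k _ _ = steps i<k (trans (toℕ-fromℕ< _) (m<n⇒m%n≡m (s≤s i<k)))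
    ... | tri≈ _ i≡k _ = wraps i≡k (trans (toℕ-fromℕ< _) (trans (cong (λ x → suc x % n) i≡k) (n%n≡0 n)))
    ... | tri> _ _ i>k = ⊥-elim (ℕ.<⇒≱ i>k (ℕ.≤-pred (toℕ<n i)))

  next-injective : ∀ {i j} → next i ≡ next j → i ≡ j
  next-injective {i} {j} eq with nextView i | nextView j
  ... | wraps i≡k _   | wraps j≡k _   = toℕ-injective (trans i≡k (sym j≡k))
  ... | steps _ ni≡1+i | steps _ nj≡1+j =
    toℕ-injective (ℕ.suc-injective (trans (sym ni≡1+i) (trans (cong toℕ eq) nj≡1+j)))
  ... | wraps _ ni≡0   | steps _ nj≡1+j with () ← trans (sym ni≡0) (trans (cong toℕ eq) nj≡1+j)
  ... | steps _ ni≡1+i | wraps _ nj≡0   with () ← trans (sym nj≡0) (trans (cong toℕ (sym eq)) ni≡1+i)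

  next-prev : ∀ c → next (prev c) ≡ c
  next-prev zero with nextView (prev zero)
  ... | wraps _ n≡0 = toℕ-injective n≡0
  ... | steps k<k _ = ⊥-elim (ℕ.<-irrefl (toℕ-fromℕ (suc k)) k<k)
  next-prev (suc c) with nextView (prev (suc c))
  ... | wraps c≡k _   = ⊥-elim (ℕ.<-irrefl (trans (sym (toℕ-inject₁ c)) c≡k) (toℕ<n c))
  ... | steps _ n≡1+c = toℕ-injective (trans n≡1+c (cong suc (toℕ-inject₁ c)))

  next≢id : ∀ i → ¬ next i ≡ i
  next≢id i eq with nextView i
  ... | wraps i≡k ni≡0   with () ← trans (sym i≡k) (trans (cong toℕ (sym eq)) ni≡0)
  ... | steps _ ni≡1+i = ℕ.1+n≢n (trans (sym ni≡1+i) (cong toℕ eq))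

  prev≢id : ∀ c → ¬ prev c ≡ c
  prev≢id c eq = next≢id (prev c) (trans (next-prev c) (sym eq))

  ≡ᵇ-next : ∀ c j → (c ≡ᵇ next j) ≡ (prev c ≡ᵇ j)
  ≡ᵇ-next c j with c ≟ next j | prev c ≟ j
  ... | yes _    | yes _    = refl
  ... | no _     | no _     = refl
  ... | yes refl | no pc≢j  = ⊥-elim (pc≢j (next-injective (next-prev (next j))))
  ... | no c≢nj  | yes refl = ⊥-elim (c≢nj (sym (next-prev c)))

module Wheel (k : ℕ) where

  open Cycle k public

  m : ℕ
  m = n + n

  W : Graph
  W = wheel n

  open Presentation W public

  spoke rim : Fin n → Fin m
  spoke c = c ↑ˡ n
  rim j   = n ↑ʳ j

  edge-elim : ∀ {P : Fin m → Set} → (∀ c → P (spoke c)) → (∀ j → P (rim j)) → ∀ e → P e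
  edge-elim {P} P-spoke P-rim e = subst P (join-splitAt n n e) (by-side (splitAt n e))
    where
    by-side : ∀ s → P (join n n s)
    by-side (inj₁ c) = P-spoke c
    by-side (inj₂ j) = P-rim j

  src-spoke : ∀ c → src W (spoke c) ≡ zero
  src-spoke c rewrite splitAt-↑ˡ n c n = refl

  tgt-spoke : ∀ c → tgt W (spoke c) ≡ suc c
  tgt-spoke c rewrite splitAt-↑ˡ n c n = refl

  src-rim : ∀ j → src W (rim j) ≡ suc j
  src-rim j rewrite splitAt-↑ʳ n n j = refl

  tgt-rim : ∀ j → tgt W (rim j) ≡ suc (next j)
  tgt-rim j rewrite splitAt-↑ʳ n n j = refl

  spoke≡ᵇspoke : ∀ c c′ → (spoke c ≡ᵇ spoke c′) ≡ (c ≡ᵇ c′)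
  spoke≡ᵇspoke = ≡ᵇ-injective spoke (↑ˡ-injective n _ _)

  rim≡ᵇrim : ∀ j j′ → (rim j ≡ᵇ rim j′) ≡ (j ≡ᵇ j′)
  rim≡ᵇrim = ≡ᵇ-injective rim (↑ʳ-injective n _ _)

  spoke≢rim : ∀ c j → ¬ spoke c ≡ rim j
  spoke≢rim c j eq with trans (sym (splitAt-↑ˡ n c n)) (trans (cong (splitAt n) eq) (splitAt-↑ʳ n n j))
  ... | ()

  spoke≡ᵇrim : ∀ c j → (spoke c ≡ᵇ rim j) ≡ false
  spoke≡ᵇrim c j = ≢⇒≡ᵇ-false (spoke≢rim c j)

  rim≡ᵇspoke : ∀ j c → (rim j ≡ᵇ spoke c) ≡ false
  rim≡ᵇspoke j c = ≢⇒≡ᵇ-false (spoke≢rim c j ∘ sym)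

  incident? : ∀ v e → Dec ((v ≡ src W e) ⊎ (v ≡ tgt W e))
  incident? v e = (v ≟ src W e) ⊎-dec (v ≟ tgt W e)

  incidentᵇ : Fin (suc n) → Fin m → Bool
  incidentᵇ v e = does (incident? v e)

  incidentᵇ-spoke : ∀ v c → incidentᵇ v (spoke c) ≡ (v ≡ᵇ zero) ∨ (v ≡ᵇ suc c)
  incidentᵇ-spoke v c = cong₂ (λ a b → does ((v ≟ a) ⊎-dec (v ≟ b))) (src-spoke c) (tgt-spoke c)

  incidentᵇ-rim : ∀ v j → incidentᵇ v (rim j) ≡ (v ≡ᵇ suc j) ∨ (v ≡ᵇ suc (next j))
  incidentᵇ-rim v j = cong₂ (λ a b → does ((v ≟ a) ⊎-dec (v ≟ b))) (src-rim j) (tgt-rim j)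

  star : Fin (suc n) → List (Fin m)
  star zero    = map spoke (allFin n)
  star (suc c) = spoke c ∷ rim c ∷ rim (prev c) ∷ []

  oddMultiplicity-star : ∀ v e → oddMultiplicity (star v) e ≡ incidentᵇ v e
  oddMultiplicity-star zero = edge-elim centre-spoke centre-rim
    where
    open ≡-Reasoning
    centre-spoke : ∀ c → oddMultiplicity (star zero) (spoke c) ≡ incidentᵇ zero (spoke c)
    centre-spoke c = begin
      oddMultiplicity (star zero) (spoke c)             ≡⟨ parity-map (_≡ᵇ spoke c) spoke (allFin n) ⟩
      parity (λ c′ → spoke c′ ≡ᵇ spoke c) (allFin n)    ≡⟨ parity-cong (λ c′ → spoke≡ᵇspoke c′ c) (allFin n) ⟩
      oddMultiplicity (allFin n) c                      ≡⟨ oddMultiplicity-allFin c ⟩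
      true                                              ≡⟨ incidentᵇ-spoke zero c ⟨
      incidentᵇ zero (spoke c)                          ∎
    centre-rim : ∀ j → oddMultiplicity (star zero) (rim j) ≡ incidentᵇ zero (rim j)
    centre-rim j = begin
      oddMultiplicity (star zero) (rim j)               ≡⟨ parity-map (_≡ᵇ rim j) spoke (allFin n) ⟩
      parity (λ c′ → spoke c′ ≡ᵇ rim j) (allFin n)      ≡⟨ parity-cong (λ c′ → spoke≡ᵇrim c′ j) (allFin n) ⟩
      parity (λ _ → false) (allFin n)                   ≡⟨ parity-false (allFin n) ⟩
      false                                             ≡⟨ incidentᵇ-rim zero j ⟨
      incidentᵇ zero (rim j)                            ∎
  oddMultiplicity-star (suc c) = edge-elim cycle-spoke cycle-rim
    where
    open ≡-Reasoning
    cycle-spoke : ∀ c′ → oddMultiplicity (star (suc c)) (spoke c′) ≡ incidentᵇ (suc c) (spoke c′)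
    cycle-spoke c′ = begin
      oddMultiplicity (star (suc c)) (spoke c′)
        ≡⟨ cong₂ (λ a b → a xor (b xor ((rim (prev c) ≡ᵇ spoke c′) xor false))) (spoke≡ᵇspoke c c′) (rim≡ᵇspoke c c′) ⟩
      (c ≡ᵇ c′) xor ((rim (prev c) ≡ᵇ spoke c′) xor false)
        ≡⟨ cong (λ b → (c ≡ᵇ c′) xor (b xor false)) (rim≡ᵇspoke (prev c) c′) ⟩
      (c ≡ᵇ c′) xor false                               ≡⟨ xor-identityʳ (c ≡ᵇ c′) ⟩
      c ≡ᵇ c′                                           ≡⟨ incidentᵇ-spoke (suc c) c′ ⟨
      incidentᵇ (suc c) (spoke c′)                      ∎
    cycle-rim : ∀ j → oddMultiplicity (star (suc c)) (rim j) ≡ incidentᵇ (suc c) (rim j)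
    cycle-rim j = begin
      oddMultiplicity (star (suc c)) (rim j)
        ≡⟨ cong₂ (λ a b → a xor (b xor ((rim (prev c) ≡ᵇ rim j) xor false))) (spoke≡ᵇrim c j) (rim≡ᵇrim c j) ⟩
      (c ≡ᵇ j) xor ((rim (prev c) ≡ᵇ rim j) xor false)
        ≡⟨ cong (λ b → (c ≡ᵇ j) xor b) (trans (xor-identityʳ _) (rim≡ᵇrim (prev c) j)) ⟩
      (c ≡ᵇ j) xor (prev c ≡ᵇ j)                        ≡⟨ xor≡∨ (λ c≡j pc≡j → prev≢id c (trans (≡ᵇ⇒≡ pc≡j) (sym (≡ᵇ⇒≡ c≡j)))) ⟩
      (c ≡ᵇ j) ∨ (prev c ≡ᵇ j)                          ≡⟨ cong ((c ≡ᵇ j) ∨_) (≡ᵇ-next c j) ⟨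
      (c ≡ᵇ j) ∨ (c ≡ᵇ next j)                          ≡⟨ incidentᵇ-rim (suc c) j ⟨
      incidentᵇ (suc c) (rim j)                         ∎

  incident≡star : ∀ v → incident W v ≡ filterᵇ (oddMultiplicity (star v)) (allFin m)
  incident≡star v = trans (filter≡filterᵇ (incident? v) (allFin m))
                          (sym (filterᵇ-cong (All.universal (oddMultiplicity-star v) (allFin m))))

  -- Coordinate t of φ(s_c) = e_c + e_{prev c} and of φ(r_j) = e_j.
  edgeImage : Fin m → Fin n → Bool
  edgeImage e t = [ (λ c → (c ≡ᵇ t) xor (c ≡ᵇ next t)) , (λ j → j ≡ᵇ t) ]′ (splitAt n e)

  edgeImage-spoke : ∀ c t → edgeImage (spoke c) t ≡ (c ≡ᵇ t) xor (c ≡ᵇ next t)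
  edgeImage-spoke c t rewrite splitAt-↑ˡ n c n = refl

  edgeImage-rim : ∀ j t → edgeImage (rim j) t ≡ (j ≡ᵇ t)
  edgeImage-rim j t rewrite splitAt-↑ʳ n n j = refl

  bit : Fin n → Word m → Bool
  bit t = parity (λ l → edgeImage (edge l) t)

  φ : Word m → Vec Bool n
  φ w = tabulate (λ t → bit t w)

  parity-edgeImage-star : ∀ v t → parity (λ e → edgeImage e t) (star v) ≡ false
  parity-edgeImage-star zero t = begin
    parity (λ e → edgeImage e t) (map spoke (allFin n))  ≡⟨ parity-map (λ e → edgeImage e t) spoke (allFin n) ⟩
    parity (λ c → edgeImage (spoke c) t) (allFin n)      ≡⟨ parity-cong (λ c → edgeImage-spoke c t) (allFin n) ⟩
    parity (λ c → (c ≡ᵇ t) xor (c ≡ᵇ next t)) (allFin n) ≡⟨ parity-xor (_≡ᵇ t) (_≡ᵇ next t) (allFin n) ⟩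
    oddMultiplicity (allFin n) t xor oddMultiplicity (allFin n) (next t)
      ≡⟨ cong₂ _xor_ (oddMultiplicity-allFin t) (oddMultiplicity-allFin (next t)) ⟩
    false                                                ∎
    where open ≡-Reasoning
  parity-edgeImage-star (suc c) t = begin
    edgeImage (spoke c) t xor (edgeImage (rim c) t xor (edgeImage (rim (prev c)) t xor false))
      ≡⟨ cong₂ (λ a b → a xor (b xor (edgeImage (rim (prev c)) t xor false))) (edgeImage-spoke c t) (edgeImage-rim c t) ⟩
    ((c ≡ᵇ t) xor (c ≡ᵇ next t)) xor ((c ≡ᵇ t) xor (edgeImage (rim (prev c)) t xor false))
      ≡⟨ cong₂ (λ a b → ((c ≡ᵇ t) xor a) xor ((c ≡ᵇ t) xor (b xor false))) (≡ᵇ-next c t) (edgeImage-rim (prev c) t) ⟩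
    ((c ≡ᵇ t) xor (prev c ≡ᵇ t)) xor ((c ≡ᵇ t) xor ((prev c ≡ᵇ t) xor false))
      ≡⟨ xor-assoc (c ≡ᵇ t) (prev c ≡ᵇ t) _ ⟩
    (c ≡ᵇ t) xor ((prev c ≡ᵇ t) xor ((c ≡ᵇ t) xor ((prev c ≡ᵇ t) xor false)))
      ≡⟨ xor-twice (c ≡ᵇ t) (prev c ≡ᵇ t) ⟩
    false                                                ∎
    where open ≡-Reasoning

  bit-incident : ∀ t v → bit t (map pos (incident W v)) ≡ false
  bit-incident t v = begin
    bit t (map pos (incident W v))                                      ≡⟨ parity-map _ pos (incident W v) ⟩
    parity (λ e → edgeImage e t) (incident W v)                         ≡⟨ cong (parity (λ e → edgeImage e t)) (incident≡star v) ⟩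
    parity (λ e → edgeImage e t) (filterᵇ (oddMultiplicity (star v)) (allFin m))
      ≡⟨ parity-filterᵇ-oddMultiplicity (λ e → edgeImage e t) (star v) ⟩
    parity (λ e → edgeImage e t) (star v)                               ≡⟨ parity-edgeImage-star v t ⟩
    false                                                               ∎
    where open ≡-Reasoning

  bit-++ : ∀ t u v → bit t (u ++ v) ≡ bit t u xor bit t v
  bit-++ t = parity-++ (λ l → edgeImage (edge l) t)

  bit-respects-~ : ∀ t {u v} → u ~ v → bit t u ≡ bit t v
  bit-respects-~ t ~refl                  = refl
  bit-respects-~ t (~sym v~u)             = sym (bit-respects-~ t v~u)
  bit-respects-~ t (~trans u~w w~v)       = trans (bit-respects-~ t u~w) (bit-respects-~ t w~v)
  bit-respects-~ t (~ctx {u} {v} a b u~v) = begin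
    bit t (a ++ u ++ b)                   ≡⟨ bit-++ t a (u ++ b) ⟩
    bit t a xor bit t (u ++ b)            ≡⟨ cong (bit t a xor_) (bit-++ t u b) ⟩
    bit t a xor (bit t u xor bit t b)     ≡⟨ cong (λ x → bit t a xor (x xor bit t b)) (bit-respects-~ t u~v) ⟩
    bit t a xor (bit t v xor bit t b)     ≡⟨ cong (bit t a xor_) (bit-++ t v b) ⟨
    bit t a xor bit t (v ++ b)            ≡⟨ bit-++ t a (v ++ b) ⟨
    bit t (a ++ v ++ b)                   ∎
    where open ≡-Reasoning
  bit-respects-~ t (~free (pos e))        = xor-twice (edgeImage e t) false
  bit-respects-~ t (~free (neg e))        = xor-twice (edgeImage e t) false
  bit-respects-~ t (~sq e)                = xor-twice (edgeImage e t) false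
  bit-respects-~ t (~comm v e e′ _ _)     = xor-twice (edgeImage e t) (edgeImage e′ t)
  bit-respects-~ t (~vert v)              = bit-incident t v

  φ-respects-~ : ∀ {u v} → u ~ v → φ u ≡ φ v
  φ-respects-~ u~v = Vec.tabulate-cong (λ t → bit-respects-~ t u~v)

  φ-++ : ∀ u v → φ (u ++ v) ≡ zipWith _xor_ (φ u) (φ v)
  φ-++ u v = trans (Vec.tabulate-cong (λ t → bit-++ t u v)) (sym (zipWith-tabulate _xor_ (λ t → bit t u) (λ t → bit t v)))

  φ-[] : φ [] ≡ replicate n false
  φ-[] = trans (Vec.tabulate-allFin (λ _ → false)) (Vec.map-const (Data.Vec.allFin n) false)

  φ-invW : ∀ w → φ (invW w) ≡ φ w
  φ-invW w = Vec.tabulate-cong λ t → begin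
    bit t (reverse (map flipL w))   ≡⟨ parity-reverse _ (map flipL w) ⟩
    bit t (map flipL w)             ≡⟨ parity-map _ flipL w ⟩
    parity (λ l → edgeImage (edge (flipL l)) t) w ≡⟨ parity-cong (λ l → cong (λ e → edgeImage e t) (edge-flipL l)) w ⟩
    bit t w                         ∎
    where open ≡-Reasoning

  spoke∈centre : ∀ c → spoke c ∈ incident W zero
  spoke∈centre c = ∈-filter⁺ (incident? zero) (∈-allFin (spoke c)) (inj₁ (sym (src-spoke c)))

  star⊆incident : ∀ c → All (_∈ incident W (suc c)) (star (suc c))
  star⊆incident c =
    ∈-filter⁺ (incident? (suc c)) (∈-allFin (spoke c)) (inj₂ (sym (tgt-spoke c))) ∷
    ∈-filter⁺ (incident? (suc c)) (∈-allFin (rim c)) (inj₁ (sym (src-rim c))) ∷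
    ∈-filter⁺ (incident? (suc c)) (∈-allFin (rim (prev c))) (inj₂ (sym (trans (tgt-rim (prev c)) (cong suc (next-prev c))))) ∷ []

  spoke-relator : ∀ c → (pos (spoke c) ∷ pos (rim c) ∷ pos (rim (prev c)) ∷ []) ~ []
  spoke-relator c = begin
    word (star (suc c))                           ≈⟨ word~normal (star (suc c)) (star⊆incident c) ⟩
    normal (oddMultiplicity (star (suc c)))       ≡⟨ cong (map pos) (incident≡star (suc c)) ⟨
    map pos (incident W (suc c))                  ≈⟨ ~vert (suc c) ⟩
    []                                            ∎
    where
    open SetoidReasoning ~-setoid
    open NormalForm (λ e → e) (_∈ incident W (suc c)) (incident-commute {suc c})

  spoke~rims : ∀ c → (pos (spoke c) ∷ []) ~ (pos (rim (prev c)) ∷ pos (rim c) ∷ [])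
  spoke~rims c =
    ~trans (~sym (~ctx (pos (spoke c) ∷ []) [] (~sq (rim c))))
    (~trans (~sym (~ctx (pos (spoke c) ∷ pos (rim c) ∷ []) (pos (rim c) ∷ []) (~sq (rim (prev c)))))
            (~ctx [] (pos (rim (prev c)) ∷ pos (rim c) ∷ []) (spoke-relator c)))

  spokes-commute : ∀ c c′ → Commute (pos (spoke c)) (pos (spoke c′))
  spokes-commute c c′ = incident-commute {zero} (spoke∈centre c) (spoke∈centre c′)

  module Spokes = CommutingGenerators spoke spokes-commute

  rim₀rim~spokes : ∀ j → ∃ λ cs → (pos (rim zero) ∷ pos (rim j) ∷ []) ~ Spokes.word cs
  rim₀rim~spokes = <-weakInduction _ ([] , ~sq (rim zero)) extend
    where
    extend : ∀ j → ∃ (λ cs → (pos (rim zero) ∷ pos (rim (inject₁ j)) ∷ []) ~ Spokes.word cs) →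
                   ∃ (λ cs → (pos (rim zero) ∷ pos (rim (suc j)) ∷ []) ~ Spokes.word cs)
    extend j (cs , r₀rⱼ~cs) = cs ++ [ suc j ] , (begin
      pos (rim zero) ∷ pos (rim (suc j)) ∷ []
        ≈⟨ ~ctx (pos (rim zero) ∷ []) (pos (rim (suc j)) ∷ []) (~sq (rim (inject₁ j))) ⟨
      pos (rim zero) ∷ pos (rim (inject₁ j)) ∷ pos (rim (inject₁ j)) ∷ pos (rim (suc j)) ∷ []
        ≈⟨ ~ctx [] (pos (rim (inject₁ j)) ∷ pos (rim (suc j)) ∷ []) r₀rⱼ~cs ⟩
      Spokes.word cs ++ pos (rim (inject₁ j)) ∷ pos (rim (suc j)) ∷ []
        ≈⟨ ~-prepend (Spokes.word cs) (spoke~rims (suc j)) ⟨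
      Spokes.word cs ++ Spokes.word [ suc j ]
        ≡⟨ map-++ (pos ∘ spoke) cs [ suc j ] ⟨
      Spokes.word (cs ++ [ suc j ])  ∎)
      where open SetoidReasoning ~-setoid

  rim₀-commute : ∀ j → Commute (pos (rim zero)) (pos (rim j))
  rim₀-commute j = let (cs , r₀rⱼ~cs) = rim₀rim~spokes j in
    Spokes.commute-of-product cs (~sq (rim zero)) (~sq (rim j)) r₀rⱼ~cs

  rim-pair~spokes : ∀ i j → ∃ λ cs → (pos (rim i) ∷ pos (rim j) ∷ []) ~ Spokes.word cs
  rim-pair~spokes i j with rim₀rim~spokes i | rim₀rim~spokes j
  ... | csᵢ , r₀rᵢ~csᵢ | csⱼ , r₀rⱼ~csⱼ = csᵢ ++ csⱼ , (begin
    pos (rim i) ∷ pos (rim j) ∷ []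
      ≈⟨ ~ctx (pos (rim i) ∷ []) (pos (rim j) ∷ []) (~sq (rim zero)) ⟨
    pos (rim i) ∷ pos (rim zero) ∷ pos (rim zero) ∷ pos (rim j) ∷ []
      ≈⟨ ~ctx [] (pos (rim zero) ∷ pos (rim j) ∷ []) (rim₀-commute i) ⟨
    pos (rim zero) ∷ pos (rim i) ∷ pos (rim zero) ∷ pos (rim j) ∷ []
      ≈⟨ ~ctx [] (pos (rim zero) ∷ pos (rim j) ∷ []) r₀rᵢ~csᵢ ⟩
    Spokes.word csᵢ ++ pos (rim zero) ∷ pos (rim j) ∷ []
      ≈⟨ ~-prepend (Spokes.word csᵢ) r₀rⱼ~csⱼ ⟩
    Spokes.word csᵢ ++ Spokes.word csⱼ
      ≡⟨ map-++ (pos ∘ spoke) csᵢ csⱼ ⟨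
    Spokes.word (csᵢ ++ csⱼ)  ∎)
    where open SetoidReasoning ~-setoid

  rims-commute : ∀ i j → Commute (pos (rim i)) (pos (rim j))
  rims-commute i j = let (cs , rᵢrⱼ~cs) = rim-pair~spokes i j in
    Spokes.commute-of-product cs (~sq (rim i)) (~sq (rim j)) rᵢrⱼ~cs

  module Rims = NormalForm rim (λ _ → ⊤) (λ {i} {j} _ _ → rims-commute i j)

  letter~rims : ∀ l → ∃ λ js → (l ∷ []) ~ Rims.word js
  letter~rims (pos e) = edge-elim {λ e → ∃ λ js → (pos e ∷ []) ~ Rims.word js}
                                  (λ c → (prev c ∷ c ∷ []) , spoke~rims c) (λ j → [ j ] , ~refl) e
  letter~rims (neg e) = let (js , e~js) = letter~rims (pos e) in js , ~trans (neg~pos e) e~js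

  word~rims : ∀ w → ∃ λ js → w ~ Rims.word js
  word~rims []      = [] , ~refl
  word~rims (l ∷ w) with letter~rims l | word~rims w
  ... | js , l~js | js′ , w~js′ = js ++ js′ ,
    ~trans (~ctx [] w l~js)
    (~trans (~-prepend (Rims.word js) w~js′)
            (Setoid.reflexive ~-setoid (sym (map-++ (pos ∘ rim) js js′))))

  bit-rims : ∀ t js → bit t (Rims.word js) ≡ oddMultiplicity js t
  bit-rims t js = trans (parity-map _ (pos ∘ rim) js) (parity-cong (λ j → edgeImage-rim j t) js)

  normal : Vec Bool n → Word m
  normal y = Rims.normal (lookup y)

  φ-normal : ∀ y → φ (normal y) ≡ y
  φ-normal y = trans (Vec.tabulate-cong λ t → trans (bit-rims t (filterᵇ (lookup y) (allFin n)))
                                                    (oddMultiplicity-filterᵇ-allFin (lookup y) t))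
                     (Vec.tabulate∘lookup y)

  oddMultiplicity-rims : ∀ {w js} → w ~ Rims.word js → ∀ t → oddMultiplicity js t ≡ lookup (φ w) t
  oddMultiplicity-rims {w} {js} w~js t = begin
    oddMultiplicity js t    ≡⟨ bit-rims t js ⟨
    bit t (Rims.word js)    ≡⟨ bit-respects-~ t w~js ⟨
    bit t w                 ≡⟨ Vec.lookup∘tabulate (λ t → bit t w) t ⟨
    lookup (φ w) t          ∎
    where open ≡-Reasoning

  normal-φ : ∀ w → w ~ normal (φ w)
  normal-φ w = let (js , w~js) = word~rims w in begin
    w                                   ≈⟨ w~js ⟩
    Rims.word js                        ≈⟨ Rims.word~normal js (All.universal (λ _ → tt) js) ⟩
    Rims.normal (oddMultiplicity js)    ≡⟨ cong Rims.word (filterᵇ-cong (All.universal (oddMultiplicity-rims w~js) (allFin n))) ⟩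
    normal (φ w)                        ∎
    where open SetoidReasoning ~-setoid

  φ-isGroupIsomorphism : GroupMorphisms.IsGroupIsomorphism (Γ W) (Z2^ n) φ
  φ-isGroupIsomorphism = record
    { isGroupMonomorphism = record
      { isGroupHomomorphism = record
        { isMonoidHomomorphism = record
          { isMagmaHomomorphism = record
            { isRelHomomorphism = record { cong = φ-respects-~ }
            ; homo = φ-++
            }
          ; ε-homo = φ-[]
          }
        ; ⁻¹-homo = φ-invW
        }
      ; injective = λ {u} {v} φu≡φv →
          ~trans (normal-φ u) (~trans (Setoid.reflexive ~-setoid (cong normal φu≡φv)) (~sym (normal-φ v)))
      }
    ; surjective = λ y → normal y , λ z~normal → trans (φ-respects-~ z~normal) (φ-normal y)
    }

proposition5p10 : ∀ (n : ℕ) → 3 ≤ n →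
    ∃ λ (f : Word (nE (wheel n)) → Vec Bool n) →
    GroupMorphisms.IsGroupIsomorphism (Γ (wheel n)) (Z2^ n) f
proposition5p10 (suc (suc (suc k))) (s≤s (s≤s (s≤s _))) = Wheel.φ (suc k) , Wheel.φ-isGroupIsomorphism (suc k)
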